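{- Let $t_1\ge 0$ and $t_2\ge 1$ be integers and $1\le n\le m$. If a non-adaptive $(m,s,t_1)$-graph $G_1$ and an adaptive $(m,s,t_2)$-graph $G_2$ form an admissible pair for sets of size $n$, then the query scheme $\mathcal{T}_{G_1}\wedge\mathcal{T}_{G_2}$ is satisfiable for every set $S\subseteq[m]$ of size $n$.
   Context: A non-adaptive $(m,s,t_1)$-graph is a bipartite graph $G_1$ with vertex sets $[m]$ and $V(G_1)=V_1\cup\dots\cup V_{t_1}$ (disjoint, each of size $s$), each $u\in[m]$ having a unique neighbour in each $V_i$. An adaptive $(m,s,t_2)$-graph is a bipartite graph $G_2$ with vertex sets $[m]$ and $V(G_2)$, partitioned into $2^{t_2}-1$ sets $A_\sigma$ ($\sigma$ a binary string of length at most $t_2-1$), each of size $s$, each $u\in[m]$ having exactly one edge to each $A_\sigma$; its leaves are $\bigcup_{|\sigma|=t_2-1}A_\sigma$, and $\mathrm{leaves}_{G_2}(R)$ is the set of leaves adjacent to some element of $R$. $\mathcal{T}_{G_2}$ on query $u$: if the first $i-1$ probes returned $\sigma$, the $i$-th probe reads the location of the neighbour of $u$ in $A_\sigma$; the answer of this part is the last bit read. The combined scheme $\mathcal{T}_{G_1}\wedge\mathcal{T}_{G_2}$ uses memory indexed by $V(G_1)\cup V(G_2)$ and answers ``Is $u\in S$?'' with Yes iff all $t_1$ bits at the neighbours of $u$ in $G_1$ are $1$ and the last bit read by $\mathcal{T}_{G_2}$ on $u$ is $1$; it is satisfiable for $S$ if some memory assignment makes all queries ($u\in[m]$) answered correctly.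 $\Gamma_H(R)$ is the neighbourhood of $R$ in $H$. Let $\beta=2^{t_2}-t_2$. For $|S|=n$ let $\mathrm{survivors}(S)=\{y\notin S:\Gamma_{G_1}(y)\subseteq\Gamma_{G_1}(S)\}$ and $\mathrm{survivors}^+(S)=\{y\in\mathrm{survivors}(S):\mathrm{leaves}_{G_2}(S)\cap\mathrm{leaves}_{G_2}(\{y\})\ne\emptyset\}$. $(G_1,G_2)$ is an admissible pair for sets of size $n$ if (P1) for all $S\subseteq[m]$ with $|S|=n$, $|\mathrm{survivors}(S)|\le 10m(n/s)^{t_1}$; and (P2) for all $S\subseteq[m]$ with $|S|=n$ and all $T\subseteq S\cup\mathrm{survivors}^+(S)$, $|\Gamma_{G_2}(T)|\ge\beta|T|$. -}

module Defs where

open import Data.Bool using (Bool; true; false; _∧_; not)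
open import Data.Nat using (ℕ; zero; suc; _+_; _*_; _∸_; _^_; _≤_; _<_)
open import Data.Nat.Properties using (n<1+n; n≤1+n; <⇒≤)
open import Data.Fin using (Fin; toℕ; _≟_)
open import Data.Fin.Properties using (toℕ<n)
open import Data.List using (List; []; _∷_; concatMap; map; length; filter)
open import Data.Bool.ListAction using (any; all)
open import Data.Nat.ListAction using (sum)
open import Data.List.Base using (allFin)
open import Data.Vec using (Vec; []; _∷_; _∷ʳ_; lookup; tabulate)
open import Data.Fin.Subset using (Subset)
open import Relation.Nullary.Decidable using (⌊_⌋)

-- A non-adaptive (m,s,t1)-graph: V(G1) = V_1 ∪ … ∪ V_t1, each V_i ≅ Fin s;
-- g1 u i is the unique neighbour of u in V_i.
NonAdaptive : ℕ → ℕ → ℕ → Set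
NonAdaptive m s t1 = Fin m → Fin t1 → Fin s

-- An adaptive (m,s,t2)-graph: parts A_σ for binary strings σ of length k < t2,
-- each A_σ ≅ Fin s; g2 u k _ σ is the unique neighbour of u in A_σ.
Adaptive : ℕ → ℕ → ℕ → Set
Adaptive m s t2 = Fin m → (k : ℕ) → .(k < t2) → Vec Bool k → Fin s

-- Memory for V(G1) and for V(G2) (disjoint union: a pair of memories).
Mem1 : ℕ → ℕ → Set
Mem1 s t1 = Fin t1 → Fin s → Bool

Mem2 : ℕ → ℕ → Set
Mem2 s t2 = (k : ℕ) → .(k < t2) → Vec Bool k → Fin s → Bool

allVecs : (k : ℕ) → List (Vec Bool k)
allVecs zero = [] ∷ []
allVecs (suc k) = concatMap (λ v → (false ∷ v) ∷ (true ∷ v) ∷ []) (allVecs k)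

count : List Bool → ℕ
count bs = length (filter (λ b → b Data.Bool.≟ true) bs)

_==_ : ∀ {s} → Fin s → Fin s → Bool
x == y = ⌊ x ≟ y ⌋

module _ {m s t2 : ℕ} (g2 : Adaptive m s t2) (M2 : Mem2 s t2) (u : Fin m) where
  trace : (k : ℕ) → .(k ≤ t2) → Vec Bool k
  trace zero _ = []
  trace (suc k) p = σ ∷ʳ M2 k p σ (g2 u k p σ)
    where σ = trace k (<⇒≤ p)

-- last bit read by T_{G2} on u (t2 = 0 is excluded by hypothesis; default value)
lastBit : ∀ {m s} t2 → Adaptive m s t2 → Mem2 s t2 → Fin m → Bool
lastBit zero g2 M2 u = true
lastBit (suc k) g2 M2 u = M2 k (n<1+n k) σ (g2 u k (n<1+n k) σ)
  where σ = trace g2 M2 u k (n≤1+n k)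

answer : ∀ {m s t1} t2 → NonAdaptive m s t1 → Adaptive m s t2 →
         Mem1 s t1 → Mem2 s t2 → Fin m → Bool
answer {m} {s} {t1} t2 g1 g2 M1 M2 u =
  all (λ i → M1 i (g1 u i)) (allFin t1) ∧ lastBit t2 g2 M2 u

Satisfiable : ∀ {m s t1} t2 → NonAdaptive m s t1 → Adaptive m s t2 → Subset m → Set
Satisfiable {m} {s} {t1} t2 g1 g2 S =
  Σ (Mem1 s t1) λ M1 → Σ (Mem2 s t2) λ M2 →
    (u : Fin m) → answer t2 g1 g2 M1 M2 u ≡ lookup S u
  where open import Data.Product using (Σ)
        open import Relation.Binary.PropositionalEquality using (_≡_)

survivors : ∀ {m s t1} → NonAdaptive m s t1 → Subset m → Subset m
survivors {m} {s} {t1} g1 S = tabulate λ y →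
  not (lookup S y) ∧
  all (λ i → any (λ x → lookup S x ∧ (g1 x i == g1 y i)) (allFin m)) (allFin t1)

-- leaves_{G2}(S) ∩ leaves_{G2}({y}) ≠ ∅  (leaves = parts A_σ with |σ| = t2 - 1)
leavesMeet : ∀ {m s} t2 → Adaptive m s t2 → Subset m → Fin m → Bool
leavesMeet zero g2 S y = false
leavesMeet {m} (suc k) g2 S y =
  any (λ σ → any (λ x → lookup S x ∧ (g2 x k (n<1+n k) σ == g2 y k (n<1+n k) σ))
                 (allFin m))
      (allVecs k)

survivors⁺ : ∀ {m s t1} t2 → NonAdaptive m s t1 → Adaptive m s t2 → Subset m → Subset m
survivors⁺ t2 g1 g2 S = tabulate λ y →
  lookup (survivors g1 S) y ∧ leavesMeet t2 g2 S y

Γ₂-size : ∀ {m s} t2 → Adaptive m s t2 → Subset m → ℕ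
Γ₂-size {m} {s} t2 g2 T =
  sum (map (λ k → sum (map (λ σ →
         count (map (λ j → any (λ u → lookup T u ∧ (g2 u (toℕ k) (toℕ<n k) σ == j))
                               (allFin m))
                    (allFin s)))
       (allVecs (toℕ k))))
     (allFin t2))

β : ℕ → ℕ
β t2 = 2 ^ t2 ∸ t2

open import Data.Fin.Subset using (∣_∣; _⊆_; _∪_)
open import Relation.Binary.PropositionalEquality using (_≡_)
open import Data.Product using (_×_)

-- (P1), with (n/s)^t1 cleared of denominators (s ≥ 1 whenever m ≥ 1)
P1 : ∀ {m s t1} (n : ℕ) → NonAdaptive m s t1 → Set
P1 {m} {s} {t1} n g1 = (S : Subset m) → ∣ S ∣ ≡ n →
  ∣ survivors g1 S ∣ * s ^ t1 ≤ 10 * m * n ^ t1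

P2 : ∀ {m s t1} t2 (n : ℕ) → NonAdaptive m s t1 → Adaptive m s t2 → Set
P2 {m} t2 n g1 g2 = (S : Subset m) → ∣ S ∣ ≡ n →
  (T : Subset m) → T ⊆ (S ∪ survivors⁺ t2 g1 g2 S) →
  β t2 * ∣ T ∣ ≤ Γ₂-size t2 g2 T

AdmissiblePair : ∀ {m s t1} t2 (n : ℕ) → NonAdaptive m s t1 → Adaptive m s t2 → Set
AdmissiblePair t2 n g1 g2 = P1 n g1 × P2 t2 n g1 g2

module Submission where

-- Each u ∈ X = S ∪ survivors⁺(S) gets β = 2^t₂ − t₂ nodes of G₂ of its own: by (P2) the neighbourhoods in
-- G₂ satisfy Hall's condition for demand β on X.  Since u has exactly one neighbour in each of the 2^t₂ − 1
-- parts A_σ, it owns that neighbour in all but fewer than t₂ of them.  An owned node stores the direction in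
-- which its owner misses fewer parts below.  Along the walk of 𝒯_{G₂} on u, the number of missed parts below
-- plus the depth stays below t₂: where u owns its neighbour the missed parts below at least halve, elsewhere
-- they drop by one.  So the walk ends at a leaf node owned by u, which stores whether u ∈ S.  The bits of
-- 𝒯_{G₁} mark Γ_{G₁}(S) and reject everything outside S ∪ survivors(S); a survivor outside survivors⁺(S)
-- ends at a leaf node that no element of S owns, which stores 0.

open import Defs
open import Data.Nat using (ℕ; _≤_)
open import Data.Fin.Subset using (Subset; ∣_∣)
open import Relation.Binary.PropositionalEquality using (_≡_)

open import Algebra.Bundles using (CommutativeMonoid)
import Algebra.Properties.CommutativeSemigroup as CommutativeSemigroupProperties
open import Data.Bool using (Bool; true; false; _∧_; _∨_; not; if_then_else_)
open import Data.Bool.ListAction using (or; any; all)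
open import Data.Bool.Properties
  using (T-≡; not-injective; ∧-assoc; ∧-distribʳ-∨; ∧-zeroʳ; ∧-identityʳ; ∨-commutativeMonoid)
  renaming (_≟_ to _≟ᵇ_)
open import Data.Empty using (⊥-elim)
open import Data.Fin using (Fin; _≟_; toℕ; fromℕ<)
open import Data.Fin.Properties using (toℕ<n; toℕ-injective; toℕ-fromℕ<)
open import Data.Fin.Subset using (_⊆_; ∁; _∩_; _∪_; ⁅_⁆)
open import Data.Fin.Subset.Properties using (anySubset?; x∈⁅x⁆; x∈⁅y⁆⇒x≡y; p∩q⊆q)
open import Data.List using (List; []; _∷_; _++_; map; concatMap; cartesianProduct; allFin)
open import Data.List.Membership.Propositional using (_∈_; lose; find)
open import Data.List.Membership.Propositional.Properties using (∈-allFin; ∈-map⁺; ∈-map⁻; ∈-concatMap⁺)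
open import Data.List.Properties using (map-++; map-∘; map-tabulate; map-cong)
open import Data.List.Relation.Binary.Disjoint.Propositional using (Disjoint)
open import Data.List.Relation.Unary.All as All using (All; []; _∷_)
import Data.List.Relation.Unary.All.Properties as All
import Data.List.Relation.Unary.AllPairs as AllPairs
import Data.List.Relation.Unary.AllPairs.Properties as AllPairs
open import Data.List.Relation.Unary.Any using (here; there)
open import Data.List.Relation.Unary.Any.Properties using (any⁺; any⁻)
open import Data.List.Relation.Unary.Unique.Propositional using (Unique; []; _∷_)
import Data.List.Relation.Unary.Unique.Propositional.Properties as Unique
open import Data.Maybe using (Maybe; just; nothing)
open import Data.Nat using (zero; suc; _+_; _*_; _∸_; _^_; _<_; z≤n; s≤s; s≤s⁻¹; _≤?_; _<?_)
open import Data.Nat.ListAction using (sum)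
open import Data.Nat.ListAction.Properties using (sum-++)
open import Data.Nat.Properties renaming (_≟_ to _≟ℕ_)
open import Data.Product using (∃; _×_; _,_; proj₁; proj₂)
import Data.Product.Properties as Product
open import Data.Sum using (_⊎_; inj₁; inj₂)
open import Data.Vec using (Vec; []; _∷_; _∷ʳ_; lookup; tail)
open import Data.Vec.Properties using (lookup∘tabulate; lookup-zipWith; lookup-map; []=⇒lookup; lookup⇒[]=)
import Data.Vec.Properties as Vec
open import Function using (id; _∘_; Equivalence)
open import Relation.Binary.Definitions using (DecidableEquality)
open import Relation.Binary.PropositionalEquality
open import Relation.Nullary using (¬_; Dec; yes; no; _×-dec_)
open import Relation.Nullary.Decidable using (⌊_⌋; map′)

open CommutativeSemigroupProperties (CommutativeMonoid.commutativeSemigroup ∨-commutativeMonoid)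
  using () renaming (interchange to ∨-interchange)
open CommutativeSemigroupProperties +-commutativeSemigroup using () renaming (interchange to +-interchange)

bit : Bool → ℕ
bit false = 0
bit true  = 1

bit≤1 : ∀ b → bit b ≤ 1
bit≤1 false = z≤n
bit≤1 true  = ≤-refl

bits-∧ʳ : ∀ a b c d x → bit a + (bit b + bit c) ≤ bit d →
          bit (a ∧ x) + (bit (b ∧ x) + bit (c ∧ x)) ≤ bit (d ∧ x)
bits-∧ʳ a b c d false _ rewrite ∧-zeroʳ a | ∧-zeroʳ b | ∧-zeroʳ c | ∧-zeroʳ d = z≤n
bits-∧ʳ a b c d true  le rewrite ∧-identityʳ a | ∧-identityʳ b | ∧-identityʳ c | ∧-identityʳ d = le

module _ {a} {A : Set a} where

  ∑ : List A → (A → ℕ) → ℕ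
  ∑ xs f = sum (map f xs)

  ∑-cong : ∀ xs {f g : A → ℕ} → (∀ x → f x ≡ g x) → ∑ xs f ≡ ∑ xs g
  ∑-cong []       f≗g = refl
  ∑-cong (x ∷ xs) f≗g = cong₂ _+_ (f≗g x) (∑-cong xs f≗g)

  ∑-mono : ∀ xs {f g : A → ℕ} → (∀ x → f x ≤ g x) → ∑ xs f ≤ ∑ xs g
  ∑-mono []       f≤g = z≤n
  ∑-mono (x ∷ xs) f≤g = +-mono-≤ (f≤g x) (∑-mono xs f≤g)

  ∑-distrib-+ : ∀ xs (f g : A → ℕ) → ∑ xs (λ x → f x + g x) ≡ ∑ xs f + ∑ xs g
  ∑-distrib-+ []       f g = refl
  ∑-distrib-+ (x ∷ xs) f g =
    trans (cong ((f x + g x) +_) (∑-distrib-+ xs f g)) (+-interchange (f x) (g x) (∑ xs f) (∑ xs g))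

  ∑-*-distribˡ : ∀ xs c (f : A → ℕ) → ∑ xs (λ x → c * f x) ≡ c * ∑ xs f
  ∑-*-distribˡ []       c f = sym (*-zeroʳ c)
  ∑-*-distribˡ (x ∷ xs) c f =
    trans (cong (c * f x +_) (∑-*-distribˡ xs c f)) (sym (*-distribˡ-+ c (f x) _))

  ∑-++ : ∀ xs ys (f : A → ℕ) → ∑ (xs ++ ys) f ≡ ∑ xs f + ∑ ys f
  ∑-++ xs ys f = trans (cong sum (map-++ f xs ys)) (sum-++ (map f xs) (map f ys))

  ∑-∸ : ∀ xs {f g : A → ℕ} → (∀ x → g x ≤ f x) → ∑ xs (λ x → f x ∸ g x) + ∑ xs g ≡ ∑ xs f
  ∑-∸ xs {f} {g} g≤f =
    trans (sym (∑-distrib-+ xs (λ x → f x ∸ g x) g)) (∑-cong xs λ x → m∸n+n≡m (g≤f x))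

  ∈⇒≤∑ : ∀ {x xs} (f : A → ℕ) → x ∈ xs → f x ≤ ∑ xs f
  ∈⇒≤∑ f (here refl) = m≤m+n _ _
  ∈⇒≤∑ f (there x∈)  = ≤-trans (∈⇒≤∑ f x∈) (m≤n+m _ _)

  ∑-positive : ∀ xs (f : A → ℕ) → 0 < ∑ xs f → ∃ λ x → x ∈ xs × 0 < f x
  ∑-positive (x ∷ xs) f 0<∑ with f x in fx≡
  ... | suc _ = x , here refl , subst (0 <_) (sym fx≡) (s≤s z≤n)
  ... | zero with ∑-positive xs f 0<∑
  ...   | y , y∈ , 0<fy = y , there y∈ , 0<fy

  ∑-bit-mono : ∀ xs {P Q : A → Bool} → (∀ x → P x ≡ true → Q x ≡ true) →
               ∑ xs (bit ∘ P) ≤ ∑ xs (bit ∘ Q)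
  ∑-bit-mono xs {P} {Q} P⇒Q = ∑-mono xs λ x → pointwise x (P x) refl
    where
    pointwise : ∀ x b → P x ≡ b → bit (P x) ≤ bit (Q x)
    pointwise x true  Px rewrite Px | P⇒Q x Px = ≤-refl
    pointwise x false Px rewrite Px = z≤n

  ∑-bit-false : ∀ {xs} (P : A → Bool) → All (λ x → P x ≡ false) xs → ∑ xs (bit ∘ P) ≡ 0
  ∑-bit-false P []         = refl
  ∑-bit-false P (Px ∷ Pxs) rewrite Px = ∑-bit-false P Pxs

  false-elsewhere : ∀ (P : A → Bool) {x₀ y} → (∀ x → P x ≡ true → x ≡ x₀) → x₀ ≢ y → P y ≡ false
  false-elsewhere P {y = y} P⇒x₀ x₀≢y with P y in Py
  ... | false = refl
  ... | true  = ⊥-elim (x₀≢y (sym (P⇒x₀ y Py)))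

  ∑-bit-unique : ∀ {xs} (P : A → Bool) x₀ → Unique xs → (∀ x → P x ≡ true → x ≡ x₀) →
                 ∑ xs (bit ∘ P) ≤ bit (P x₀)
  ∑-bit-unique P x₀ [] P⇒x₀ = z≤n
  ∑-bit-unique {x ∷ xs} P x₀ (x∉xs ∷ xs!) P⇒x₀ with P x in Px
  ... | false = ∑-bit-unique P x₀ xs! P⇒x₀
  ... | true with refl ← P⇒x₀ x Px
    rewrite Px | ∑-bit-false P (All.map (false-elsewhere P P⇒x₀) x∉xs) = ≤-refl

module _ {a b} {A : Set a} {B : Set b} where

  ∑-concatMap : ∀ (g : A → List B) xs (f : B → ℕ) → ∑ (concatMap g xs) f ≡ ∑ xs (λ x → ∑ (g x) f)
  ∑-concatMap g []       f = refl
  ∑-concatMap g (x ∷ xs) f = trans (∑-++ (g x) _ f) (cong (∑ (g x) f +_) (∑-concatMap g xs f))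

  ∑-map : ∀ (g : A → B) xs (f : B → ℕ) → ∑ (map g xs) f ≡ ∑ xs (f ∘ g)
  ∑-map g xs f = cong sum (sym (map-∘ xs))

module _ {a b} {A : Set a} {B : Set b} where

  ∑-cartesianProduct : ∀ xs (ys : List B) (f : A × B → ℕ) →
                       ∑ (cartesianProduct xs ys) f ≡ ∑ xs (λ x → ∑ ys (λ y → f (x , y)))
  ∑-cartesianProduct []       ys f = refl
  ∑-cartesianProduct (x ∷ xs) ys f =
    trans (∑-++ (map (x ,_) ys) _ f) (cong₂ _+_ (∑-map (x ,_) ys f) (∑-cartesianProduct xs ys f))

count-map : ∀ {a} {A : Set a} (P : A → Bool) xs → count (map P xs) ≡ ∑ xs (bit ∘ P)
count-map P []       = refl
count-map P (x ∷ xs) with P x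
... | true  = cong suc (count-map P xs)
... | false = count-map P xs

∑-allFin-suc : ∀ n (f : Fin (suc n) → ℕ) →
               ∑ (allFin (suc n)) f ≡ f Fin.zero + ∑ (allFin n) (f ∘ Fin.suc)
∑-allFin-suc n f = cong (f Fin.zero +_)
  (cong sum (trans (map-tabulate Fin.suc f) (sym (map-tabulate id (f ∘ Fin.suc)))))

∣p∣≡∑ : ∀ {n} (p : Subset n) → ∣ p ∣ ≡ ∑ (allFin n) (bit ∘ lookup p)
∣p∣≡∑ {zero}  []      = refl
∣p∣≡∑ {suc n} (b ∷ p) = trans (head b) (sym (∑-allFin-suc n (bit ∘ lookup (b ∷ p))))
  where
  head : ∀ b → ∣ b ∷ p ∣ ≡ bit b + ∑ (allFin n) (bit ∘ lookup p)
  head true  = cong suc (∣p∣≡∑ p)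
  head false = ∣p∣≡∑ p

module _ {a} {A : Set a} where

  any-cong : ∀ {p q : A → Bool} → (∀ x → p x ≡ q x) → ∀ xs → any p xs ≡ any q xs
  any-cong p≗q xs = cong or (map-cong p≗q xs)

  any-intro : ∀ (p : A → Bool) {x xs} → x ∈ xs → p x ≡ true → any p xs ≡ true
  any-intro p x∈xs px = Equivalence.to T-≡ (any⁺ p (lose x∈xs (Equivalence.from T-≡ px)))

  any-elim : ∀ (p : A → Bool) xs → any p xs ≡ true → ∃ λ x → x ∈ xs × p x ≡ true
  any-elim p xs any≡ with x , x∈xs , px ← find (any⁻ p xs (Equivalence.from T-≡ any≡)) =
    x , x∈xs , Equivalence.to T-≡ px

  all-intro : ∀ (p : A → Bool) xs → (∀ x → p x ≡ true) → all p xs ≡ true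
  all-intro p xs ∀p = Equivalence.to T-≡ (All.all⁻ p (All.universal (Equivalence.from T-≡ ∘ ∀p) xs))

  any-∧ʳ : ∀ (p : A → Bool) b xs → any (λ x → p x ∧ b) xs ≡ any p xs ∧ b
  any-∧ʳ p b []       = refl
  any-∧ʳ p b (x ∷ xs) =
    trans (cong ((p x ∧ b) ∨_) (any-∧ʳ p b xs)) (sym (∧-distribʳ-∨ b (p x) (any p xs)))

  any-∨ : ∀ (p q : A → Bool) xs → any (λ x → p x ∨ q x) xs ≡ any p xs ∨ any q xs
  any-∨ p q []       = refl
  any-∨ p q (x ∷ xs) =
    trans (cong ((p x ∨ q x) ∨_) (any-∨ p q xs)) (∨-interchange (p x) (q x) (any p xs) (any q xs))

∧-elim : ∀ a {b} → a ∧ b ≡ true → a ≡ true × b ≡ true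
∧-elim true {true} _ = refl , refl

module _ {ℓ} {P : Set ℓ} where

  ⌊⌋⇒ : (P? : Dec P) → ⌊ P? ⌋ ≡ true → P
  ⌊⌋⇒ (yes p) _ = p

  ⌊⌋⇐ : (P? : Dec P) → P → ⌊ P? ⌋ ≡ true
  ⌊⌋⇐ (yes _) _ = refl
  ⌊⌋⇐ (no ¬p) p = ⊥-elim (¬p p)

==-refl : ∀ {n} (i : Fin n) → (i == i) ≡ true
==-refl i = ⌊⌋⇐ (i ≟ i) refl

lookup-∩ : ∀ {n} (U T : Subset n) l → lookup (U ∩ T) l ≡ lookup U l ∧ lookup T l
lookup-∩ U T l = lookup-zipWith _∧_ l U T

lookup-∪ : ∀ {n} (U T : Subset n) l → lookup (U ∪ T) l ≡ lookup U l ∨ lookup T l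
lookup-∪ U T l = lookup-zipWith _∨_ l U T

lookup-∁ : ∀ {n} (T : Subset n) l → lookup (∁ T) l ≡ not (lookup T l)
lookup-∁ T l = lookup-map l not T

module _ {a b} {A : Set a} {B : Set b} where

  ∈-concatMap : ∀ {f : A → List B} {x xs y} → y ∈ f x → x ∈ xs → y ∈ concatMap f xs
  ∈-concatMap {f} y∈fx x∈xs = ∈-concatMap⁺ f (lose x∈xs y∈fx)

  Unique-concatMap : ∀ {f : A → List B} {xs} → Unique xs → (∀ x → Unique (f x)) →
                     (∀ {x y} → x ≢ y → Disjoint (f x) (f y)) → Unique (concatMap f xs)
  Unique-concatMap {f} {xs} xs! f! disjoint =
    Unique.concat⁺ (All.map⁺ (All.universal f! xs)) (AllPairs.map⁺ (AllPairs.map disjoint xs!))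

-- Hall's theorem with demands

module Hall {R : Set} (_≟ᵣ_ : DecidableEquality R)
            (resources : List R) (resources! : Unique resources) (m : ℕ) where

  Adjacency : Set
  Adjacency = Fin m → R → Bool

  Demand : Set
  Demand = Fin m → ℕ

  Γ : Adjacency → Subset m → R → Bool
  Γ adj T r = any (λ l → lookup T l ∧ adj l r) (allFin m)

  ∣Γ∣ : Adjacency → Subset m → ℕ
  ∣Γ∣ adj T = ∑ resources (bit ∘ Γ adj T)

  total : Demand → ℕ
  total = ∑ (allFin m)

  _↾_ : Demand → Subset m → Demand
  (d ↾ T) l = if lookup T l then d l else 0

  HallCondition : Adjacency → Demand → Set
  HallCondition adj d = ∀ T → total (d ↾ T) ≤ ∣Γ∣ adj T

  restrict : Adjacency → (R → Bool) → Adjacency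
  restrict adj keep l r = adj l r ∧ keep r

  claims : Maybe (Fin m) → Fin m → Bool
  claims nothing   l = false
  claims (just l′) l = l′ == l

  supplied : (R → Maybe (Fin m)) → Fin m → ℕ
  supplied owner l = ∑ resources (λ r → bit (claims (owner r) l))

  record Assignment (adj : Adjacency) (d : Demand) : Set where
    field
      owner     : R → Maybe (Fin m)
      owner-adj : ∀ r {l} → owner r ≡ just l → adj l r ≡ true
      supply    : ∀ l → d l ≤ supplied owner l

  claims⇒≡ : ∀ o {l} → claims o l ≡ true → o ≡ just l
  claims⇒≡ (just l′) l′==l = cong just (⌊⌋⇒ (l′ ≟ _) l′==l)

  Γ-intro : ∀ adj T {l r} → lookup T l ≡ true → adj l r ≡ true → Γ adj T r ≡ true
  Γ-intro adj T {l} {r} l∈T lr = any-intro (λ l → lookup T l ∧ adj l r) (∈-allFin l) (cong₂ _∧_ l∈T lr)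

  Γ-elim : ∀ adj T {r} → Γ adj T r ≡ true → ∃ λ l → lookup T l ≡ true × adj l r ≡ true
  Γ-elim adj T {r} Γr with l , _ , lr ← any-elim (λ l → lookup T l ∧ adj l r) (allFin m) Γr =
    l , ∧-elim (lookup T l) lr

  Γ-restrict : ∀ adj keep U r → Γ (restrict adj keep) U r ≡ Γ adj U r ∧ keep r
  Γ-restrict adj keep U r =
    trans (any-cong (λ l → sym (∧-assoc (lookup U l) (adj l r) (keep r))) (allFin m))
          (any-∧ʳ (λ l → lookup U l ∧ adj l r) (keep r) (allFin m))

  Γ-∪ : ∀ adj U T r → Γ adj (U ∪ T) r ≡ Γ adj U r ∨ Γ adj T r
  Γ-∪ adj U T r =
    trans (any-cong distrib (allFin m))
          (any-∨ (λ l → lookup U l ∧ adj l r) (λ l → lookup T l ∧ adj l r) (allFin m))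
    where
    distrib : ∀ l → lookup (U ∪ T) l ∧ adj l r ≡ (lookup U l ∧ adj l r) ∨ (lookup T l ∧ adj l r)
    distrib l = trans (cong (_∧ adj l r) (lookup-∪ U T l)) (∧-distribʳ-∨ (adj l r) (lookup U l) (lookup T l))

  ∣Γ∣-∩ : ∀ adj U T → ∣Γ∣ adj (U ∩ T) ≤ ∣Γ∣ adj U
  ∣Γ∣-∩ adj U T = ∑-bit-mono resources λ r Γr →
    let l , l∈U∩T , lr = Γ-elim adj (U ∩ T) Γr
    in Γ-intro adj U (proj₁ (∧-elim (lookup U l) (trans (sym (lookup-∩ U T l)) l∈U∩T))) lr

  ∣Γ∣-restrict : ∀ adj (drop : R → Bool) U →
                 ∣Γ∣ adj U ≤ ∣Γ∣ (restrict adj (not ∘ drop)) U + ∑ resources (bit ∘ drop)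
  ∣Γ∣-restrict adj drop U = begin
    ∑ resources (bit ∘ Γ adj U)                                          ≤⟨ ∑-mono resources split ⟩
    ∑ resources (λ r → bit (Γ adj U r ∧ not (drop r)) + bit (drop r))     ≡⟨ ∑-distrib-+ resources _ _ ⟩
    ∑ resources (λ r → bit (Γ adj U r ∧ not (drop r))) + ∑ resources (bit ∘ drop)
      ≡⟨ cong (_+ ∑ resources (bit ∘ drop))
              (∑-cong resources λ r → cong bit (sym (Γ-restrict adj (not ∘ drop) U r))) ⟩
    ∣Γ∣ (restrict adj (not ∘ drop)) U + ∑ resources (bit ∘ drop)         ∎
    where
    open ≤-Reasoning
    bit-split : ∀ a b → bit a ≤ bit (a ∧ not b) + bit b
    bit-split false b     = z≤n
    bit-split true  false = ≤-refl
    bit-split true  true  = s≤s z≤n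
    split : ∀ r → bit (Γ adj U r) ≤ bit (Γ adj U r ∧ not (drop r)) + bit (drop r)
    split r = bit-split (Γ adj U r) (drop r)

  ↾-∈ : ∀ d T {l} → lookup T l ≡ true → (d ↾ T) l ≡ d l
  ↾-∈ d T l∈T rewrite l∈T = refl

  ↾-∉ : ∀ d T {l} → lookup T l ≡ false → (d ↾ ∁ T) l ≡ d l
  ↾-∉ d T {l} l∉T rewrite lookup-∁ T l | l∉T = refl

  ↾-↾ : ∀ d T U l → ((d ↾ T) ↾ U) l ≡ (d ↾ (U ∩ T)) l
  ↾-↾ d T U l rewrite lookup-∩ U T l with lookup U l
  ... | true  = refl
  ... | false = refl

  ↾-∪ : ∀ d T U l → (d ↾ (U ∪ T)) l ≡ ((d ↾ ∁ T) ↾ U) l + (d ↾ T) l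
  ↾-∪ d T U l rewrite lookup-∪ U T l | lookup-∁ T l with lookup U l | lookup T l
  ... | true  | true  = refl
  ... | true  | false = sym (+-identityʳ (d l))
  ... | false | true  = refl
  ... | false | false = refl

  ↾-∸ : ∀ d e U l → ((λ l → d l ∸ e l) ↾ U) l ≡ (d ↾ U) l ∸ (e ↾ U) l
  ↾-∸ d e U l with lookup U l
  ... | true  = refl
  ... | false = refl

  ↾-mono : ∀ {d e} U → (∀ l → e l ≤ d l) → ∀ l → (e ↾ U) l ≤ (d ↾ U) l
  ↾-mono U e≤d l with lookup U l
  ... | true  = e≤d l
  ... | false = z≤n

  total-↾-∁ : ∀ d T → total (d ↾ T) + total (d ↾ ∁ T) ≡ total d
  total-↾-∁ d T = trans (sym (∑-distrib-+ (allFin m) (d ↾ T) (d ↾ ∁ T))) (∑-cong (allFin m) split)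
    where
    split : ∀ l → (d ↾ T) l + (d ↾ ∁ T) l ≡ d l
    split l rewrite lookup-∁ T l with lookup T l
    ... | true  = +-identityʳ (d l)
    ... | false = refl

  total-const↾ : ∀ c T → total ((λ _ → c) ↾ T) ≡ c * ∣ T ∣
  total-const↾ c T = begin
    total ((λ _ → c) ↾ T)                   ≡⟨ ∑-cong (allFin m) (λ l → if-bit (lookup T l)) ⟩
    ∑ (allFin m) (λ l → c * bit (lookup T l)) ≡⟨ ∑-*-distribˡ (allFin m) c (bit ∘ lookup T) ⟩
    c * ∑ (allFin m) (bit ∘ lookup T)         ≡⟨ cong (c *_) (∣p∣≡∑ T) ⟨
    c * ∣ T ∣                                 ∎
    where
    open ≡-Reasoning
    if-bit : ∀ b → (if b then c else 0) ≡ c * bit b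
    if-bit true  = sym (*-identityʳ c)
    if-bit false = sym (*-zeroʳ c)

  ≤total : ∀ d l → d l ≤ total d
  ≤total d l = ∈⇒≤∑ d (∈-allFin l)

  avoiding : Adjacency → Subset m → Adjacency
  avoiding adj T = restrict adj (not ∘ Γ adj T)

  hall-↾ : ∀ {adj d} T → HallCondition adj d → HallCondition adj (d ↾ T)
  hall-↾ {adj} {d} T hall U = begin
    total ((d ↾ T) ↾ U)  ≡⟨ ∑-cong (allFin m) (↾-↾ d T U) ⟩
    total (d ↾ (U ∩ T))  ≤⟨ hall (U ∩ T) ⟩
    ∣Γ∣ adj (U ∩ T)      ≤⟨ ∣Γ∣-∩ adj U T ⟩
    ∣Γ∣ adj U            ∎
    where open ≤-Reasoning

  -- Γ(U ∪ T) splits into Γ(T) and the part of Γ(U) outside Γ(T); the tightness of T pays for the former.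
  hall-↾∁ : ∀ {adj d} T → HallCondition adj d → ∣Γ∣ adj T ≤ total (d ↾ T) →
            HallCondition (avoiding adj T) (d ↾ ∁ T)
  hall-↾∁ {adj} {d} T hall tight U = +-cancelʳ-≤ (total (d ↾ T)) _ _ (begin
    total ((d ↾ ∁ T) ↾ U) + total (d ↾ T)
      ≡⟨ sym (∑-distrib-+ (allFin m) ((d ↾ ∁ T) ↾ U) (d ↾ T)) ⟩
    ∑ (allFin m) (λ l → ((d ↾ ∁ T) ↾ U) l + (d ↾ T) l)
      ≡⟨ ∑-cong (allFin m) (λ l → sym (↾-∪ d T U l)) ⟩
    total (d ↾ (U ∪ T))                             ≤⟨ hall (U ∪ T) ⟩
    ∣Γ∣ adj (U ∪ T)                                 ≤⟨ ∣Γ∣-restrict adj (Γ adj T) (U ∪ T) ⟩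
    ∣Γ∣ (avoiding adj T) (U ∪ T) + ∣Γ∣ adj T         ≤⟨ +-mono-≤ (∑-bit-mono resources ∪⇒U) tight ⟩
    ∣Γ∣ (avoiding adj T) U + total (d ↾ T)          ∎)
    where
    open ≤-Reasoning
    drop-T : ∀ a b → (a ∨ b) ∧ not b ≡ true → a ∧ not b ≡ true
    drop-T true  false _ = refl
    drop-T true  true  ()
    drop-T false true  ()
    ∪⇒U : ∀ r → Γ (avoiding adj T) (U ∪ T) r ≡ true → Γ (avoiding adj T) U r ≡ true
    ∪⇒U r Γr rewrite Γ-restrict adj (not ∘ Γ adj T) U r =
      drop-T (Γ adj U r) (Γ adj T r)
        (trans (cong (_∧ not (Γ adj T r)) (sym (Γ-∪ adj U T r)))
               (trans (sym (Γ-restrict adj (not ∘ Γ adj T) (U ∪ T) r)) Γr))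

  supplied-mono : ∀ (o o′ : R → Maybe (Fin m)) l →
                  (∀ r → claims (o r) l ≡ true → claims (o′ r) l ≡ true) → supplied o l ≤ supplied o′ l
  supplied-mono o o′ l = ∑-bit-mono resources

  unassigned : ∀ {adj d} → total d ≡ 0 → Assignment adj d
  unassigned {d = d} total≡0 = record
    { owner     = λ _ → nothing
    ; owner-adj = λ _ ()
    ; supply    = λ l → ≤-trans (subst (d l ≤_) total≡0 (≤total d l)) z≤n
    }

  merge : ∀ {adj d} T → Assignment adj (d ↾ T) → Assignment (avoiding adj T) (d ↾ ∁ T) →
          Assignment adj d
  merge {adj} {d} T inside outside = record
    { owner     = owner
    ; owner-adj = owner-adj
    ; supply    = supply
    }
    where
    module I = Assignment inside
    module O = Assignment outside
    owner : R → Maybe (Fin m)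
    owner r = if Γ adj T r then I.owner r else O.owner r

    owner-adj : ∀ r {l} → owner r ≡ just l → adj l r ≡ true
    owner-adj r {l} with Γ adj T r
    ... | true  = I.owner-adj r
    ... | false = proj₁ ∘ ∧-elim (adj l r) ∘ O.owner-adj r

    inside-kept : ∀ {l} → lookup T l ≡ true → ∀ r → claims (I.owner r) l ≡ true → claims (owner r) l ≡ true
    inside-kept l∈T r claim with Γ adj T r in Γr
    ... | true  = claim
    ... | false with () ← trans (sym (Γ-intro adj T l∈T (I.owner-adj r (claims⇒≡ (I.owner r) claim)))) Γr

    outside-kept : ∀ {l} r → claims (O.owner r) l ≡ true → claims (owner r) l ≡ true
    outside-kept {l} r claim with Γ adj T r | ∧-elim (adj l r) (O.owner-adj r (claims⇒≡ (O.owner r) claim))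
    ... | false | _      = claim
    ... | true  | _ , ()

    supply : ∀ l → d l ≤ supplied owner l
    supply l with lookup T l in l∈T
    ... | true  = ≤-trans (≤-reflexive (sym (↾-∈ d T l∈T)))
                          (≤-trans (I.supply l) (supplied-mono I.owner owner l (inside-kept l∈T)))
    ... | false = ≤-trans (≤-reflexive (sym (↾-∉ d T l∈T)))
                          (≤-trans (O.supply l) (supplied-mono O.owner owner l outside-kept))

  Tight : Adjacency → Demand → Subset m → Set
  Tight adj d T = 0 < total (d ↾ T) × total (d ↾ T) < total d × ∣Γ∣ adj T ≤ total (d ↾ T)

  tight? : ∀ adj d → Dec (∃ (Tight adj d))
  tight? adj d = anySubset? λ T →
    (0 <? total (d ↾ T)) ×-dec (total (d ↾ T) <? total d) ×-dec (∣Γ∣ adj T ≤? total (d ↾ T))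

  total-↾-∁< : ∀ d T → 0 < total (d ↾ T) → total (d ↾ ∁ T) < total d
  total-↾-∁< d T 0<dT = subst (total (d ↾ ∁ T) <_) (total-↾-∁ d T) (m<n+m (total (d ↾ ∁ T)) 0<dT)

  bit-positive : ∀ {b} → 0 < bit b → b ≡ true
  bit-positive {true} _ = refl

  hall-⁅⁆ : ∀ {adj d} → HallCondition adj d → ∀ l → d l ≤ ∣Γ∣ adj ⁅ l ⁆
  hall-⁅⁆ {adj} {d} hall l = ≤-trans (≤-reflexive (sym (↾-∈ d ⁅ l ⁆ ([]=⇒lookup (x∈⁅x⁆ l)))))
                                     (≤-trans (≤total (d ↾ ⁅ l ⁆) l) (hall ⁅ l ⁆))

  adjacent-resource : ∀ {adj d l₀} → HallCondition adj d → 0 < d l₀ →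
                      ∃ λ r₀ → r₀ ∈ resources × adj l₀ r₀ ≡ true
  adjacent-resource {adj} {d} {l₀} hall 0<dl₀
    with r₀ , r₀∈ , 0<Γr₀ ← ∑-positive resources (bit ∘ Γ adj ⁅ l₀ ⁆) (≤-trans 0<dl₀ (hall-⁅⁆ hall l₀))
    with l , l∈⁅l₀⁆ , lr₀ ← Γ-elim adj ⁅ l₀ ⁆ (bit-positive 0<Γr₀)
    with refl ← x∈⁅y⁆⇒x≡y l₀ (lookup⇒[]= l ⁅ l₀ ⁆ l∈⁅l₀⁆) = r₀ , r₀∈ , lr₀

  -- Without a tight set, one unit of demand at l₀ can be served by an adjacent r₀ and both removed.
  module Peel {adj d} (hall : HallCondition adj d) (slack : ¬ ∃ (Tight adj d))
              {l₀ r₀} (0<dl₀ : 0 < d l₀) (r₀∈ : r₀ ∈ resources) (l₀r₀ : adj l₀ r₀ ≡ true) where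

    is-r₀ : R → Bool
    is-r₀ r = ⌊ r ≟ᵣ r₀ ⌋

    adj′ : Adjacency
    adj′ = restrict adj (not ∘ is-r₀)

    unit : Demand
    unit l = bit (l₀ == l)

    d′ : Demand
    d′ l = d l ∸ unit l

    unit≤d : ∀ l → unit l ≤ d l
    unit≤d l with l₀ == l in l₀==l
    ... | false = z≤n
    ... | true with refl ← ⌊⌋⇒ (l₀ ≟ l) l₀==l = 0<dl₀

    1≤total-unit↾ : ∀ U → lookup U l₀ ≡ true → 1 ≤ total (unit ↾ U)
    1≤total-unit↾ U l₀∈U = ≤-trans (≤-reflexive (sym (trans (↾-∈ unit U l₀∈U) (cong bit (==-refl l₀)))))
                                   (≤total (unit ↾ U) l₀)

    total-d′↾ : ∀ U → total (d′ ↾ U) + total (unit ↾ U) ≡ total (d ↾ U)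
    total-d′↾ U = trans (cong (_+ total (unit ↾ U)) (∑-cong (allFin m) (↾-∸ d unit U)))
                        (∑-∸ (allFin m) (↾-mono U unit≤d))

    1≤total-unit : 1 ≤ total unit
    1≤total-unit = ≤-trans (≤-reflexive (cong bit (sym (==-refl l₀)))) (≤total unit l₀)

    total-d′< : total d′ < total d
    total-d′< = begin-strict
      total d′                 <⟨ m<m+n (total d′) 1≤total-unit ⟩
      total d′ + total unit    ≡⟨ ∑-∸ (allFin m) unit≤d ⟩
      total d                  ∎
      where open ≤-Reasoning

    ∣Γ∣≤∣Γ′∣+1 : ∀ U → ∣Γ∣ adj U ≤ ∣Γ∣ adj′ U + 1
    ∣Γ∣≤∣Γ′∣+1 U = ≤-trans (∣Γ∣-restrict adj is-r₀ U)
      (+-monoʳ-≤ (∣Γ∣ adj′ U) (≤-trans (∑-bit-unique is-r₀ r₀ resources! (λ r → ⌊⌋⇒ (r ≟ᵣ r₀))) (bit≤1 _)))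

    total-↾< : ∀ U → lookup U l₀ ≡ false → total (d ↾ U) < total d
    total-↾< U l₀∉U = subst (total (d ↾ U) <_) (total-↾-∁ d U) (m<m+n (total (d ↾ U)) 0<d∁U)
      where
      0<d∁U : 0 < total (d ↾ ∁ U)
      0<d∁U = ≤-trans (subst (0 <_) (sym (↾-∉ d U l₀∉U)) 0<dl₀) (≤total (d ↾ ∁ U) l₀)

    hall-avoiding-l₀ : ∀ U → lookup U l₀ ≡ false → total (d ↾ U) ≤ ∣Γ∣ adj′ U
    hall-avoiding-l₀ U l₀∉U with 0 <? total (d ↾ U) | ∣Γ∣ adj U ≤? total (d ↾ U)
    ... | no ¬0< | _       = subst (_≤ ∣Γ∣ adj′ U) (sym (n≤0⇒n≡0 (≮⇒≥ ¬0<))) z≤n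
    ... | yes 0< | yes ∣Γ∣≤ = ⊥-elim (slack (U , 0< , total-↾< U l₀∉U , ∣Γ∣≤))
    ... | yes 0< | no ∣Γ∣≰ =
      s≤s⁻¹ (≤-trans (≰⇒> ∣Γ∣≰) (≤-trans (∣Γ∣≤∣Γ′∣+1 U) (≤-reflexive (+-comm (∣Γ∣ adj′ U) 1))))

    hall′ : HallCondition adj′ d′
    hall′ U with lookup U l₀ in l₀∈U
    ... | true  = +-cancelʳ-≤ 1 _ _ (begin
      total (d′ ↾ U) + 1                   ≤⟨ +-monoʳ-≤ _ (1≤total-unit↾ U l₀∈U) ⟩
      total (d′ ↾ U) + total (unit ↾ U)    ≡⟨ total-d′↾ U ⟩
      total (d ↾ U)                        ≤⟨ hall U ⟩
      ∣Γ∣ adj U                            ≤⟨ ∣Γ∣≤∣Γ′∣+1 U ⟩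
      ∣Γ∣ adj′ U + 1                       ∎)
      where open ≤-Reasoning
    ... | false =
      ≤-trans (∑-mono (allFin m) (↾-mono U (λ l → m∸n≤m (d l) (unit l)))) (hall-avoiding-l₀ U l₀∈U)

    extend : Assignment adj′ d′ → Assignment adj d
    extend assignment′ = record
      { owner     = owner
      ; owner-adj = owner-adj
      ; supply    = supply
      }
      where
      open Assignment assignment′ renaming (owner to owner′; owner-adj to owner′-adj; supply to supply′)
      owner : R → Maybe (Fin m)
      owner r = if is-r₀ r then just l₀ else owner′ r

      owner-adj : ∀ r {l} → owner r ≡ just l → adj l r ≡ true
      owner-adj r {l} with is-r₀ r in r≡r₀
      ... | true with refl ← ⌊⌋⇒ (r ≟ᵣ r₀) r≡r₀ = λ { refl → l₀r₀ }
      ... | false = proj₁ ∘ ∧-elim (adj l r) ∘ owner′-adj r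

      r₀-claims : ∀ l → unit l ≤ ∑ resources (λ r → bit (is-r₀ r ∧ (l₀ == l)))
      r₀-claims l = subst (λ b → bit (b ∧ (l₀ == l)) ≤ ∑ resources (λ r → bit (is-r₀ r ∧ (l₀ == l))))
                          (⌊⌋⇐ (r₀ ≟ᵣ r₀) refl)
                          (∈⇒≤∑ (λ r → bit (is-r₀ r ∧ (l₀ == l))) r₀∈)

      -- r₀ is outside adj′, so owner′ never hands it out.
      claims-add : ∀ l r → bit (is-r₀ r ∧ (l₀ == l)) + bit (claims (owner′ r) l) ≤ bit (claims (owner r) l)
      claims-add l r with is-r₀ r in r≡r₀
      ... | false = ≤-refl
      ... | true with refl ← ⌊⌋⇒ (r ≟ᵣ r₀) r≡r₀ with owner′ r₀ in owner′-r₀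
      ...   | nothing = ≤-reflexive (+-identityʳ _)
      ...   | just l′ with () ←
        trans (sym (proj₂ (∧-elim (adj l′ r₀) (owner′-adj r₀ owner′-r₀)))) (cong not r≡r₀)

      supply : ∀ l → d l ≤ supplied owner l
      supply l = begin
        d l                                                          ≤⟨ m≤n+m∸n (d l) (unit l) ⟩
        unit l + d′ l                                                ≤⟨ +-mono-≤ (r₀-claims l) (supply′ l) ⟩
        ∑ resources (λ r → bit (is-r₀ r ∧ (l₀ == l))) + supplied owner′ l
          ≡⟨ ∑-distrib-+ resources _ _ ⟨
        ∑ resources (λ r → bit (is-r₀ r ∧ (l₀ == l)) + bit (claims (owner′ r) l))
          ≤⟨ ∑-mono resources (claims-add l) ⟩
        supplied owner l                                             ∎
        where open ≤-Reasoning

  assign : ∀ N {adj d} → total d ≤ N → HallCondition adj d → Assignment adj d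
  assign zero    total≤0 hall = unassigned (n≤0⇒n≡0 total≤0)
  assign (suc N) {adj} {d} total≤ hall with tight? adj d
  ... | yes (T , 0<dT , dT<d , tight) =
    merge T (assign N (shrink dT<d) (hall-↾ T hall))
            (assign N (shrink (total-↾-∁< d T 0<dT)) (hall-↾∁ T hall tight))
    where
    shrink : ∀ {n} → n < total d → n ≤ N
    shrink n<d = s≤s⁻¹ (≤-trans n<d total≤)
  ... | no slack with 0 <? total d
  ...   | no 0≮d  = unassigned (n≤0⇒n≡0 (≮⇒≥ 0≮d))
  ...   | yes 0<d
    with l₀ , _ , 0<dl₀ ← ∑-positive (allFin m) d 0<d
    with r₀ , r₀∈ , l₀r₀ ← adjacent-resource hall 0<dl₀ =
    extend (assign N (s≤s⁻¹ (≤-trans total-d′< total≤)) hall′)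
    where open Peel hall slack 0<dl₀ r₀∈ l₀r₀

  hall-theorem : ∀ {adj d} → HallCondition adj d → Assignment adj d
  hall-theorem hall = assign _ ≤-refl hall

-- Positions of the decision tree

∈-allVecs : ∀ {k} (σ : Vec Bool k) → σ ∈ allVecs k
∈-allVecs []          = here refl
∈-allVecs (false ∷ σ) = ∈-concatMap (here refl) (∈-allVecs σ)
∈-allVecs (true ∷ σ)  = ∈-concatMap (there (here refl)) (∈-allVecs σ)

allVecs! : ∀ k → Unique (allVecs k)
allVecs! zero    = [] ∷ []
allVecs! (suc k) = Unique-concatMap (allVecs! k) (λ _ → ((λ ()) ∷ []) ∷ [] ∷ []) disjoint
  where
  tail-of : ∀ {x : Vec Bool (suc k)} {v} → x ∈ (false ∷ v) ∷ (true ∷ v) ∷ [] → tail x ≡ v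
  tail-of (here refl)         = refl
  tail-of (there (here refl)) = refl
  disjoint : ∀ {v w} → v ≢ w → Disjoint ((false ∷ v) ∷ (true ∷ v) ∷ []) ((false ∷ w) ∷ (true ∷ w) ∷ [])
  disjoint v≢w (x∈ , x∈′) = v≢w (trans (sym (tail-of x∈)) (tail-of x∈′))

∑-allVecs-1 : ∀ k → ∑ (allVecs k) (λ _ → 1) ≡ 2 ^ k
∑-allVecs-1 zero    = refl
∑-allVecs-1 (suc k) =
  trans (∑-concatMap (λ v → (false ∷ v) ∷ (true ∷ v) ∷ []) (allVecs k) (λ _ → 1))
        (trans (∑-*-distribˡ (allVecs k) 2 (λ _ → 1)) (cong (2 *_) (∑-allVecs-1 k)))

∑-allFin-2^ : ∀ n → ∑ (allFin n) (λ k → 2 ^ toℕ k) + 1 ≡ 2 ^ n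
∑-allFin-2^ zero    = refl
∑-allFin-2^ (suc n) = begin
  ∑ (allFin (suc n)) (λ k → 2 ^ toℕ k) + 1         ≡⟨ cong (_+ 1) (∑-allFin-suc n (λ k → 2 ^ toℕ k)) ⟩
  1 + ∑ (allFin n) (λ k → 2 * 2 ^ toℕ k) + 1       ≡⟨ cong (λ x → 1 + x + 1) (∑-*-distribˡ (allFin n) 2 (λ k → 2 ^ toℕ k)) ⟩
  1 + 2 * ∑ (allFin n) (λ k → 2 ^ toℕ k) + 1       ≡⟨ +-comm (1 + 2 * ∑ (allFin n) (λ k → 2 ^ toℕ k)) 1 ⟩
  2 + 2 * ∑ (allFin n) (λ k → 2 ^ toℕ k)           ≡⟨ *-distribˡ-+ 2 1 _ ⟨
  2 * (1 + ∑ (allFin n) (λ k → 2 ^ toℕ k))         ≡⟨ cong (2 *_) (trans (+-comm 1 _) (∑-allFin-2^ n)) ⟩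
  2 * 2 ^ n                                        ∎
  where open ≡-Reasoning

-- The index σ of a part A_σ of an adaptive graph of depth t.
record Pos (t : ℕ) : Set where
  constructor pos
  field
    depth    : ℕ
    .depth<t : depth < t
    path     : Vec Bool depth

open Pos using (path)

_≟ₚ_ : ∀ {t} → DecidableEquality (Pos t)
pos k _ σ ≟ₚ pos l _ τ with k ≟ℕ l
... | no k≢l   = no (k≢l ∘ cong Pos.depth)
... | yes refl = map′ (cong (pos k _)) (λ { refl → refl }) (Vec.≡-dec _≟ᵇ_ σ τ)

level : ∀ {t} (k : Fin t) → List (Pos t)
level k = map (pos (toℕ k) (toℕ<n k)) (allVecs (toℕ k))

positions : ∀ t → List (Pos t)
positions t = concatMap level (allFin t)

∈-level : ∀ {t} (i : Fin t) {k} → toℕ i ≡ k → .(p : k < t) (σ : Vec Bool k) → pos k p σ ∈ level i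
∈-level i refl p σ = ∈-map⁺ _ (∈-allVecs σ)

∈-positions : ∀ {t} k .(p : k < t) (σ : Vec Bool k) → pos k p σ ∈ positions t
∈-positions k p σ = ∈-concatMap (∈-level (fromℕ< p) (toℕ-fromℕ< p) p σ) (∈-allFin (fromℕ< p))

positions! : ∀ t → Unique (positions t)
positions! t = Unique-concatMap (Unique.allFin⁺ t) level! disjoint
  where
  level! : ∀ k → Unique (level k)
  level! k = Unique.map⁺ (λ { refl → refl }) (allVecs! (toℕ k))
  depth-of : ∀ {k x} → x ∈ level {t} k → Pos.depth x ≡ toℕ k
  depth-of x∈ with _ , _ , refl ← ∈-map⁻ _ x∈ = refl
  disjoint : ∀ {k k′} → k ≢ k′ → Disjoint (level k) (level k′)
  disjoint k≢k′ (x∈ , x∈′) = k≢k′ (toℕ-injective (trans (sym (depth-of x∈)) (depth-of x∈′)))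

∑-positions : ∀ t (f : Pos t → ℕ) →
              ∑ (positions t) f ≡ ∑ (allFin t) (λ k → ∑ (allVecs (toℕ k)) (f ∘ pos (toℕ k) (toℕ<n k)))
∑-positions t f = trans (∑-concatMap level (allFin t) f)
                        (∑-cong (allFin t) λ k → ∑-map (pos (toℕ k) (toℕ<n k)) (allVecs (toℕ k)) f)

∑-positions-1 : ∀ t → ∑ (positions t) (λ _ → 1) + 1 ≡ 2 ^ t
∑-positions-1 t = trans (cong (_+ 1) (trans (∑-positions t (λ _ → 1))
                                            (∑-cong (allFin t) λ k → ∑-allVecs-1 (toℕ k))))
                        (∑-allFin-2^ t)

-- There are 2 ^ t - 1 positions.
few-missed : ∀ t (hit : Pos t → Bool) → 2 ^ t ∸ t ≤ ∑ (positions t) (bit ∘ hit) →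
             ∑ (positions t) (bit ∘ not ∘ hit) < t
few-missed t hit many = +-cancelʳ-≤ hits _ t (begin
  suc misses + hits      ≡⟨ cong suc (trans (sym (∑-distrib-+ (positions t) _ _))
                                            (∑-cong (positions t) (bit-not+bit ∘ hit))) ⟩
  suc (∑ (positions t) (λ _ → 1)) ≡⟨ trans (+-comm 1 _) (∑-positions-1 t) ⟩
  2 ^ t                  ≤⟨ m≤n+m∸n (2 ^ t) t ⟩
  t + (2 ^ t ∸ t)        ≤⟨ +-monoʳ-≤ t many ⟩
  t + hits               ∎)
  where
  open ≤-Reasoning
  hits = ∑ (positions t) (bit ∘ hit)
  misses = ∑ (positions t) (bit ∘ not ∘ hit)
  bit-not+bit : ∀ b → bit (not b) + bit b ≡ 1
  bit-not+bit false = refl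
  bit-not+bit true  = refl

-- Greedy descent

infix 4.5 _≼_
_≼_ : ∀ {k l} → Vec Bool k → Vec Bool l → Bool
[]          ≼ _           = true
(_ ∷ _)     ≼ []          = false
(false ∷ σ) ≼ (false ∷ τ) = σ ≼ τ
(true  ∷ σ) ≼ (true  ∷ τ) = σ ≼ τ
(false ∷ _) ≼ (true  ∷ _) = false
(true  ∷ _) ≼ (false ∷ _) = false

≼-refl : ∀ {k} (σ : Vec Bool k) → σ ≼ σ ≡ true
≼-refl []          = refl
≼-refl (false ∷ σ) = ≼-refl σ
≼-refl (true  ∷ σ) = ≼-refl σ

≼-children : ∀ {k l} (σ : Vec Bool k) (τ : Vec Bool l) →
             bit ((σ ≼ τ) ∧ (τ ≼ σ)) + (bit (σ ∷ʳ false ≼ τ) + bit (σ ∷ʳ true ≼ τ)) ≤ bit (σ ≼ τ)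
≼-children []          []          = ≤-refl
≼-children []          (false ∷ τ) = ≤-refl
≼-children []          (true  ∷ τ) = ≤-refl
≼-children (_ ∷ _)     []          = z≤n
≼-children (false ∷ σ) (false ∷ τ) = ≼-children σ τ
≼-children (true  ∷ σ) (true  ∷ τ) = ≼-children σ τ
≼-children (false ∷ σ) (true  ∷ τ) = z≤n
≼-children (true  ∷ σ) (false ∷ τ) = z≤n

halving-step : ∀ {t} c x k → 2 * c ≤ x → x + k < t → suc k < t → c + suc k < t
halving-step zero    x k _    _     1+k<t = 1+k<t
halving-step (suc c) x k 2c≤x x+k<t _     = ≤-<-trans (begin
  suc c + suc k       ≡⟨ +-assoc (suc c) 1 k ⟨
  suc c + 1 + k       ≤⟨ +-monoˡ-≤ k (+-monoʳ-≤ (suc c) (s≤s z≤n)) ⟩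
  suc c + suc c + k   ≡⟨ cong (λ y → suc c + y + k) (+-identityʳ (suc c)) ⟨
  2 * suc c + k       ≤⟨ +-monoˡ-≤ k 2c≤x ⟩
  x + k               ∎) x+k<t
  where open ≤-Reasoning

module Subtrees {t : ℕ} (bad : Pos t → Bool) where

  below : Pos t → ℕ
  below π = ∑ (positions t) (λ τ → bit ((path π ≼ path τ) ∧ bad τ))

  child : ∀ {k} → .(suc k < t) → Vec Bool k → Bool → Pos t
  child q σ b = pos _ q (σ ∷ʳ b)

  below-children : ∀ {k} .(p : k < t) .(q : suc k < t) (σ : Vec Bool k) →
    bit (bad (pos k p σ)) + (below (child q σ false) + below (child q σ true)) ≤ below (pos k p σ)
  below-children p q σ = begin
    bit (bad π) + (below c₀ + below c₁)
      ≤⟨ +-monoˡ-≤ _ self≤ ⟩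
    ∑ (positions t) at-π + (below c₀ + below c₁)
      ≡⟨ cong (∑ (positions t) at-π +_) (∑-distrib-+ (positions t) (under c₀) (under c₁)) ⟨
    ∑ (positions t) at-π + ∑ (positions t) (λ τ → under c₀ τ + under c₁ τ)
      ≡⟨ ∑-distrib-+ (positions t) at-π _ ⟨
    ∑ (positions t) (λ τ → at-π τ + (under c₀ τ + under c₁ τ))
      ≤⟨ ∑-mono (positions t) (λ τ → let τ′ = path τ in
          bits-∧ʳ ((σ ≼ τ′) ∧ (τ′ ≼ σ)) (σ ∷ʳ false ≼ τ′) (σ ∷ʳ true ≼ τ′) (σ ≼ τ′) (bad τ) (≼-children σ τ′)) ⟩
    below π ∎
    where
    open ≤-Reasoning
    π = pos _ p σ
    c₀ = child q σ false
    c₁ = child q σ true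
    under : Pos t → Pos t → ℕ
    under c τ = bit ((path c ≼ path τ) ∧ bad τ)
    at-π : Pos t → ℕ
    at-π τ = bit (((σ ≼ path τ) ∧ (path τ ≼ σ)) ∧ bad τ)
    self≤ : bit (bad π) ≤ ∑ (positions t) at-π
    self≤ = subst (λ b → bit (b ∧ bad π) ≤ ∑ (positions t) at-π)
                  (cong₂ _∧_ (≼-refl σ) (≼-refl σ)) (∈⇒≤∑ at-π (∈-positions _ p σ))

  bad≤below : ∀ π → bit (bad π) ≤ below π
  bad≤below π@(pos k p σ) = subst (λ b → bit (b ∧ bad π) ≤ below π) (≼-refl σ)
                                  (∈⇒≤∑ (λ τ → bit ((σ ≼ path τ) ∧ bad τ)) (∈-positions k p σ))

  greedy : ∀ {k} → .(suc k < t) → Vec Bool k → Bool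
  greedy q σ = not ⌊ below (child q σ false) ≤? below (child q σ true) ⌋

  below-greedy : ∀ {k} .(q : suc k < t) (σ : Vec Bool k) →
                 2 * below (child q σ (greedy q σ)) ≤ below (child q σ false) + below (child q σ true)
  below-greedy q σ with below (child q σ false) ≤? below (child q σ true)
  ... | yes c₀≤c₁ = +-monoʳ-≤ (below (child q σ false)) (≤-trans (≤-reflexive (+-identityʳ _)) c₀≤c₁)
  ... | no  c₀≰c₁ = ≤-trans (+-monoˡ-≤ _ (<⇒≤ (≰⇒> c₀≰c₁)))
                            (≤-reflexive (cong (below (child q σ false) +_) (+-identityʳ _)))

  bad-child : ∀ {k} .(p : k < t) .(q : suc k < t) σ b → bad (pos k p σ) ≡ true →
              below (child q σ b) < below (pos k p σ)
  bad-child p q σ b bad≡ = ≤-trans (s≤s (child≤ b))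
    (subst (λ x → bit x + (below (child q σ false) + below (child q σ true)) ≤ below (pos _ p σ)) bad≡
           (below-children p q σ))
    where
    child≤ : ∀ b → below (child q σ b) ≤ below (child q σ false) + below (child q σ true)
    child≤ false = m≤m+n _ _
    child≤ true  = m≤n+m _ _

  greedy-child : ∀ {k} .(p : k < t) .(q : suc k < t) σ →
                 2 * below (child q σ (greedy q σ)) ≤ below (pos k p σ)
  greedy-child p q σ =
    ≤-trans (below-greedy q σ) (≤-trans (m≤n+m _ (bit (bad (pos _ p σ)))) (below-children p q σ))

  descend : ∀ {k} .(p : k < t) (q : suc k < t) σ b → bad (pos k p σ) ≡ true ⊎ b ≡ greedy q σ →
            below (pos k p σ) + k < t → below (child q σ b) + suc k < t
  descend {k} p q σ b (inj₁ bad≡) below+k<t =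
    ≤-<-trans (≤-trans (≤-reflexive (+-suc _ k)) (+-monoˡ-≤ k (bad-child p q σ b bad≡))) below+k<t
  descend {k} p q σ _ (inj₂ refl) below+k<t = halving-step _ _ k (greedy-child p q σ) below+k<t q

  Greedy : ∀ {m s} → Adaptive m s t → Mem2 s t → Fin m → Set
  Greedy g2 M2 u = ∀ k (q : suc k < t) σ → bad (pos k (<⇒≤ q) σ) ≡ false →
                   M2 k (<⇒≤ q) σ (g2 u k (<⇒≤ q) σ) ≡ greedy q σ

  descent : ∀ {m s} (g2 : Adaptive m s t) M2 u → Greedy g2 M2 u → ∑ (positions t) (bit ∘ bad) < t →
            ∀ k (p : k < t) → below (pos k p (trace g2 M2 u k (<⇒≤ p))) + k < t
  descent g2 M2 u greedy-walk few zero    p = subst (_< t) (sym (+-identityʳ _)) few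
  descent g2 M2 u greedy-walk few (suc k) q =
    descend (<⇒≤ q) q σ _ bad-or-greedy (descent g2 M2 u greedy-walk few k (<⇒≤ q))
    where
    σ = trace g2 M2 u k (<⇒≤ (<⇒≤ q))
    bad-or-greedy : bad (pos k (<⇒≤ q) σ) ≡ true ⊎ M2 k (<⇒≤ q) σ (g2 u k (<⇒≤ q) σ) ≡ greedy q σ
    bad-or-greedy with bad (pos k (<⇒≤ q) σ) in bad≡
    ... | true  = inj₁ refl
    ... | false = inj₂ (greedy-walk k q σ bad≡)

  good-leaf : ∀ {m s} (g2 : Adaptive m s t) M2 u → Greedy g2 M2 u → ∑ (positions t) (bit ∘ bad) < t →
              ∀ k (p : k < t) → suc k ≡ t → bad (pos k p (trace g2 M2 u k (<⇒≤ p))) ≡ false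
  good-leaf g2 M2 u greedy-walk few k p refl
    with bad (pos k p (trace g2 M2 u k (<⇒≤ p))) | bad≤below (pos k p (trace g2 M2 u k (<⇒≤ p)))
  ... | false | _     = refl
  ... | true  | 1≤below with () ←
    +-cancelʳ-≤ k 1 0 (≤-trans (+-monoˡ-≤ k 1≤below) (s≤s⁻¹ (descent g2 M2 u greedy-walk few k p)))

-- The scheme

module Scheme {m s t₁ k} (g1 : NonAdaptive m s t₁) (g2 : Adaptive m s (suc k)) (S : Subset m)
  (expansion : ∀ T → T ⊆ S ∪ survivors⁺ (suc k) g1 g2 S → β (suc k) * ∣ T ∣ ≤ Γ₂-size (suc k) g2 T) where

  t₂ : ℕ
  t₂ = suc k

  Node : Set
  Node = Pos t₂ × Fin s

  nodes : List Node
  nodes = cartesianProduct (positions t₂) (allFin s)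

  _≟ₙ_ : DecidableEquality Node
  _≟ₙ_ = Product.≡-dec _≟ₚ_ _≟_

  adj : Fin m → Node → Bool
  adj u (pos k′ p σ , j) = g2 u k′ p σ == j

  open Hall _≟ₙ_ nodes (Unique.cartesianProduct⁺ (positions! t₂) (Unique.allFin⁺ s)) m

  Γ₂-size≡∣Γ∣ : ∀ T → Γ₂-size t₂ g2 T ≡ ∣Γ∣ adj T
  Γ₂-size≡∣Γ∣ T = sym (begin
    ∑ nodes (bit ∘ Γ adj T)
      ≡⟨ ∑-cartesianProduct (positions t₂) (allFin s) (bit ∘ Γ adj T) ⟩
    ∑ (positions t₂) (λ π → ∑ (allFin s) (λ j → bit (Γ adj T (π , j))))
      ≡⟨ ∑-positions t₂ _ ⟩
    ∑ (allFin t₂) (λ i → ∑ (allVecs (toℕ i)) (λ σ →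
      ∑ (allFin s) (λ j → bit (Γ adj T (pos (toℕ i) (toℕ<n i) σ , j)))))
      ≡⟨ ∑-cong (allFin t₂) (λ i → ∑-cong (allVecs (toℕ i)) λ σ → sym (count-map _ (allFin s))) ⟩
    Γ₂-size t₂ g2 T ∎)
    where open ≡-Reasoning

  X : Subset m
  X = S ∪ survivors⁺ t₂ g1 g2 S

  demand : Demand
  demand = (λ _ → β t₂) ↾ X

  hall : HallCondition adj demand
  hall U = begin
    total (demand ↾ U)          ≡⟨ ∑-cong (allFin m) (↾-↾ (λ _ → β t₂) X U) ⟩
    total ((λ _ → β t₂) ↾ (U ∩ X)) ≡⟨ total-const↾ (β t₂) (U ∩ X) ⟩
    β t₂ * ∣ U ∩ X ∣              ≤⟨ expansion (U ∩ X) (p∩q⊆q U X) ⟩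
    Γ₂-size t₂ g2 (U ∩ X)        ≡⟨ Γ₂-size≡∣Γ∣ (U ∩ X) ⟩
    ∣Γ∣ adj (U ∩ X)              ≤⟨ ∣Γ∣-∩ adj U X ⟩
    ∣Γ∣ adj U                    ∎
    where open ≤-Reasoning

  -- Opaque, so that conversion checking never unfolds the construction of the owners.
  opaque
    assignment : Assignment adj demand
    assignment = hall-theorem hall

  open Assignment assignment

  node-of : Fin m → Pos t₂ → Node
  node-of u π@(pos k′ p σ) = π , g2 u k′ p σ

  owns : Fin m → Pos t₂ → Bool
  owns u π = claims (owner (node-of u π)) u

  module Walk (u : Fin m) = Subtrees (not ∘ owns u)

  -- The bit stored at a node is chosen by its owner: at an inner position, the direction of the owner's
  -- greedy walk; at a leaf, whether the owner belongs to S.  Unowned nodes store false.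
  written-by : Fin m → ∀ {k′} → Vec Bool k′ → Dec (suc k′ < t₂) → Bool
  written-by w σ (yes q) = Walk.greedy w q σ
  written-by w σ (no _)  = lookup S w

  written : Maybe (Fin m) → ∀ k′ → .(k′ < t₂) → Vec Bool k′ → Bool
  written nothing  k′ _ σ = false
  written (just w) k′ _ σ = written-by w σ (suc k′ <? t₂)

  M1 : Mem1 s t₁
  M1 i v = any (λ x → lookup S x ∧ (g1 x i == v)) (allFin m)

  M2 : Mem2 s t₂
  M2 k′ p σ j = written (owner (pos k′ p σ , j)) k′ p σ

  written-inner : ∀ w k′ .(p : k′ < t₂) (q : suc k′ < t₂) σ → written (just w) k′ p σ ≡ Walk.greedy w q σ
  written-inner w k′ p q σ = inner (suc k′ <? t₂)
    where
    inner : ∀ q? → written-by w σ q? ≡ Walk.greedy w q σ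
    inner (yes _) = refl
    inner (no ¬q) = ⊥-elim (¬q q)

  written-leaf : ∀ w σ → written (just w) k (n<1+n k) σ ≡ lookup S w
  written-leaf w σ = at-leaf (suc k <? t₂)
    where
    at-leaf : ∀ q? → written-by w σ q? ≡ lookup S w
    at-leaf (yes k<k) = ⊥-elim (<-irrefl refl k<k)
    at-leaf (no _)    = refl

  greedy-walk : ∀ u → Walk.Greedy u g2 M2 u
  greedy-walk u k′ q σ unmissed =
    trans (cong (λ o → written o k′ p σ) (claims⇒≡ (owner (node-of u (pos k′ p σ))) (not-injective unmissed)))
          (written-inner u k′ p q σ)
    where p = <⇒≤ q

  one-slot-per-position : ∀ u π → ∑ (allFin s) (λ j → bit (claims (owner (π , j)) u)) ≤ bit (owns u π)
  one-slot-per-position u π@(pos k′ p σ) =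
    ∑-bit-unique (λ j → claims (owner (π , j)) u) (g2 u k′ p σ) (Unique.allFin⁺ s)
                 (λ j claim → sym (⌊⌋⇒ (_ ≟ j) (owner-adj (π , j) (claims⇒≡ (owner (π , j)) claim))))

  owns-many : ∀ u → lookup X u ≡ true → 2 ^ t₂ ∸ t₂ ≤ ∑ (positions t₂) (bit ∘ owns u)
  owns-many u u∈X = begin
    β t₂                 ≡⟨ ↾-∈ (λ _ → β t₂) X u∈X ⟨
    demand u             ≤⟨ supply u ⟩
    supplied owner u     ≡⟨ ∑-cartesianProduct (positions t₂) (allFin s) (λ r → bit (claims (owner r) u)) ⟩
    ∑ (positions t₂) (λ π → ∑ (allFin s) (λ j → bit (claims (owner (π , j)) u)))
                         ≤⟨ ∑-mono (positions t₂) (one-slot-per-position u) ⟩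
    ∑ (positions t₂) (bit ∘ owns u) ∎
    where open ≤-Reasoning

  leaf : Fin m → Pos t₂
  leaf u = pos k (n<1+n k) (trace g2 M2 u k (n≤1+n k))

  owns-leaf : ∀ u → lookup X u ≡ true → owns u (leaf u) ≡ true
  owns-leaf u u∈X = not-injective
    (Walk.good-leaf u g2 M2 u (greedy-walk u) (few-missed t₂ (owns u) (owns-many u u∈X)) k (n<1+n k) refl)

  lastBit-X : ∀ u → lookup X u ≡ true → lastBit t₂ g2 M2 u ≡ lookup S u
  lastBit-X u u∈X =
    trans (cong (λ o → written o k (n<1+n k) (path (leaf u)))
                (claims⇒≡ (owner (node-of u (leaf u))) (owns-leaf u u∈X)))
          (written-leaf u (path (leaf u)))

  meets : ∀ {u w} σ → lookup S w ≡ true → (g2 w k (n<1+n k) σ == g2 u k (n<1+n k) σ) ≡ true →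
          leavesMeet t₂ g2 S u ≡ true
  meets {u} {w} σ w∈S same =
    any-intro _ (∈-allVecs σ) (any-intro (λ x → lookup S x ∧ (g2 x k (n<1+n k) σ == g2 u k (n<1+n k) σ))
                                         (∈-allFin w) (cong₂ _∧_ w∈S same))

  lastBit-unmet : ∀ u → leavesMeet t₂ g2 S u ≡ false → lastBit t₂ g2 M2 u ≡ false
  lastBit-unmet u unmet = written-outside-S (owner (node-of u (leaf u))) refl
    where
    σ = path (leaf u)
    written-outside-S : ∀ o → owner (node-of u (leaf u)) ≡ o → written o k (n<1+n k) σ ≡ false
    written-outside-S nothing  _    = refl
    written-outside-S (just w) own≡ with lookup S w in w∈S
    ... | false = trans (written-leaf w σ) w∈S
    ... | true  with () ← trans (sym (meets σ w∈S (owner-adj (node-of u (leaf u)) own≡))) unmet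

  covered : Fin m → Bool
  covered u = all (λ i → M1 i (g1 u i)) (allFin t₁)

  covered-S : ∀ {u} → lookup S u ≡ true → covered u ≡ true
  covered-S {u} u∈S = all-intro _ (allFin t₁) λ i →
    any-intro (λ x → lookup S x ∧ (g1 x i == g1 u i)) (∈-allFin u) (cong₂ _∧_ u∈S (==-refl (g1 u i)))

  lookup-X : ∀ u → lookup X u ≡ lookup S u ∨ ((not (lookup S u) ∧ covered u) ∧ leavesMeet t₂ g2 S u)
  lookup-X u = trans (lookup-∪ S _ u) (cong (lookup S u ∨_)
    (trans (lookup∘tabulate _ u) (cong (_∧ leavesMeet t₂ g2 S u) (lookup∘tabulate _ u))))

  S⊆X : ∀ {u} → lookup S u ≡ true → lookup X u ≡ true
  S⊆X {u} u∈S = trans (lookup-X u) (cong (_∨ ((not (lookup S u) ∧ covered u) ∧ leavesMeet t₂ g2 S u)) u∈S)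

  survivor⁺∈X : ∀ {u} → lookup S u ≡ false → covered u ≡ true → leavesMeet t₂ g2 S u ≡ true →
                lookup X u ≡ true
  survivor⁺∈X {u} u∉S cov meet =
    trans (lookup-X u) (cong₂ _∨_ u∉S (cong₂ _∧_ (cong₂ _∧_ (cong not u∉S) cov) meet))

  correct : ∀ u → answer t₂ g1 g2 M1 M2 u ≡ lookup S u
  correct u with lookup S u in u∈S
  ... | true  = cong₂ _∧_ (covered-S u∈S) (trans (lastBit-X u (S⊆X u∈S)) u∈S)
  ... | false with covered u in cov
  ...   | false = refl
  ...   | true with leavesMeet t₂ g2 S u in meet
  ...     | false = lastBit-unmet u meet
  ...     | true  = trans (lastBit-X u (survivor⁺∈X u∈S cov meet)) u∈S

lemma9 : (t1 t2 : ℕ) → 1 ≤ t2 → (m n s : ℕ) → 1 ≤ n → n ≤ m →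
    (g1 : NonAdaptive m s t1) (g2 : Adaptive m s t2) →
    AdmissiblePair t2 n g1 g2 →
    (S : Subset m) → ∣ S ∣ ≡ n → Satisfiable t2 g1 g2 S
lemma9 t1 (suc k) _ m n s _ _ g1 g2 (_ , p2) S ∣S∣≡n = M1 , M2 , correct
  where open Scheme g1 g2 S (p2 S ∣S∣≡n)
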